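{- Fix an integer $r\ge2$. There is a constant $K_r>0$ depending only on $r$ such that for every prime $p$, all integers $1\le a\le b$, and every $h\in\mathbb{Z}^{r-1}$, $$\bigl|N(h,p^b)-p^{\,b-a}N(h,p^a)\bigr|\le K_r\,p^{\,b-a}.$$
   Context: For a positive integer $m$ and $h=(h_1,\ldots,h_{r-1})\in\mathbb{Z}^{r-1}$, $N(h,m)$ is the number of $r$-tuples $(s_1,\ldots,s_r)$ of squares in $\mathbb{Z}/m\mathbb{Z}$ (elements of the form $x^2$) satisfying $s_{i+1}-s_i\equiv h_i\pmod m$ for $i=1,\ldots,r-1$. -}

module Defs where

open import Data.Nat as ℕ using (ℕ; zero; suc; _*_; _%_; _∸_)
import Data.Nat.Divisibility as ℕD
open import Data.Integer as ℤ using (ℤ; +_; _-_; ∣_∣)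
open import Data.Integer.Divisibility using (_∣_)
open import Data.Fin using (Fin; toℕ)
open import Data.Fin.Properties using (any?)
open import Data.Vec using (Vec; []; _∷_)
open import Data.Vec.Relation.Unary.All as VAll using (All)
open import Data.List using (List; []; _∷_; [_]; map; concatMap; length; filter)
open import Data.List.Base using (allFin)
open import Data.Product using (∃; _×_; _,_)
open import Data.Unit using (⊤; tt)
open import Relation.Binary.PropositionalEquality using (_≡_)
open import Relation.Nullary using (Dec; yes; no)
open import Relation.Nullary.Decidable using (_×-dec_)
open import Data.Nat.Properties using () renaming (_≟_ to _≟ℕ_)

infix 4 _≡_[mod_] _≡?_[mod_]
_≡_[mod_] : ℤ → ℤ → ℕ → Set
a ≡ b [mod m ] = (+ m) ∣ (a - b)

_≡?_[mod_] : ∀ a b m → Dec (a ≡ b [mod m ])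
a ≡? b [mod m ] = m ℕD.∣? ∣ a - b ∣

IsSquareMod : (m : ℕ) → Fin m → Set
IsSquareMod m s = ∃ λ (x : Fin m) → (+ (toℕ x * toℕ x)) ≡ (+ toℕ s) [mod m ]

isSquareMod? : ∀ m (s : Fin m) → Dec (IsSquareMod m s)
isSquareMod? m s = any? λ x → (+ (toℕ x * toℕ x)) ≡? (+ toℕ s) [mod m ]

Chain : (m : ℕ) {n : ℕ} → Vec (Fin m) n → Vec ℤ (n ∸ 1) → Set
Chain m [] [] = ⊤
Chain m (x ∷ []) [] = ⊤
Chain m (x ∷ y ∷ s) (d ∷ h) =
  ((+ toℕ y) - (+ toℕ x) ≡ d [mod m ]) × Chain m (y ∷ s) h

chain? : (m : ℕ) {n : ℕ} (s : Vec (Fin m) n) (h : Vec ℤ (n ∸ 1)) → Dec (Chain m s h)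
chain? m [] [] = yes tt
chain? m (x ∷ []) [] = yes tt
chain? m (x ∷ y ∷ s) (d ∷ h) = ((+ toℕ y) - (+ toℕ x) ≡? d [mod m ]) ×-dec chain? m (y ∷ s) h

allTuples : (m n : ℕ) → List (Vec (Fin m) n)
allTuples m zero = [ [] ]
allTuples m (suc n) = concatMap (λ x → map (x ∷_) (allTuples m n)) (allFin m)

Counted : (m : ℕ) {r : ℕ} → Vec ℤ (r ∸ 1) → Vec (Fin m) r → Set
Counted m h s = All (IsSquareMod m) s × Chain m s h

counted? : (m : ℕ) {r : ℕ} (h : Vec ℤ (r ∸ 1)) (s : Vec (Fin m) r) → Dec (Counted m h s)
counted? m h s = VAll.all? (isSquareMod? m) s ×-dec chain? m s h

-- N(h, m): number of r-tuples (s_1,…,s_r) of squares in ℤ/mℤ with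
-- s_{i+1} - s_i ≡ h_i (mod m) for i = 1..r-1
N : {r : ℕ} → Vec ℤ (r ∸ 1) → ℕ → ℕ
N {r} h m = length (filter (counted? m h) (allTuples m r))

{-# OPTIONS --safe #-}
-- Let W_m(z) ∈ {0,1} indicate that z, z + h₁, z + h₁ + h₂, … are all squares mod m, so that
-- N(h, m) = ∑_{z mod m} W_m(z). Squares mod p^b reduce to squares mod p^a, so W_{p^b} ≤ W_{p^a}.
-- Conversely, by Hensel lifting, a square s mod p^a with p^a ∤ 4s is a square mod p^b, so
-- W_{p^a} ≤ W_{p^b} + O, where O(z) counts the entries s of the chain with p^a ∣ 4s. Both W_{p^a}
-- and O are p^a-periodic, so their sums over z mod p^b are p^(b−a) times their sums over one
-- period: N(h, p^a) for W_{p^a}, and at most 4r for O, as 4s ≡ 0 (mod p^a) has at most 4 solutions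
-- s mod p^a.
-- Hence 0 ≤ p^(b−a) N(h, p^a) − N(h, p^b) ≤ 4r p^(b−a).
module Submission where

open import Defs
open import Data.Nat using (ℕ; _≤_; _<_; _∸_; _^_; _*_)
open import Data.Nat.Primality using (Prime)
open import Data.Integer using (ℤ; +_; ∣_∣) renaming (_-_ to _-ℤ_; _*_ to _*ℤ_)
open import Data.Vec using (Vec)
open import Data.Product using (Σ; _×_)

open import Data.Fin using (Fin; toℕ; fromℕ<)
open import Data.Fin.Properties using (any?; toℕ-fromℕ<)
open import Data.Integer using (-[1+_]) renaming (_+_ to _+ℤ_; -_ to -ℤ_)
open import Data.Integer.DivMod using (_%ℕ_; _/ℕ_; a≡a%ℕn+[a/ℕn]*n; n%ℕd<d)
open import Data.Integer.Divisibility.Signed using () renaming (_∣_ to _∣ℤ_)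
import Data.Integer.Divisibility.Signed as ℤ∣
import Data.Integer.Properties as ℤP
open import Data.Integer.Tactic.RingSolver using (solve-∀)
open import Data.List using (List; map; filter; length; concatMap; tabulate; allFin; _++_)
import Data.List.Properties as List
open import Data.Nat using (zero; suc; _+_; z≤n; s≤s; NonZero; NonTrivial; nonTrivial⇒n>1)
open import Data.Nat using (_≤′_; ≤′-refl; ≤′-step; _≟_)
open import Data.Nat.Coprimality using (Coprime; coprime-Bézout)
open import Data.Nat.Divisibility using (_∣_)
import Data.Nat.Divisibility as ℕ∣
open import Data.Nat.GCD using (module Bézout)
open import Data.Nat.Induction using (<-wellFounded)
open import Data.Nat.ListAction using (sum)
open import Data.Nat.ListAction.Properties using (sum-++)
open import Data.Nat.Primality using (prime[2]; prime⇒nonZero; prime⇒nonTrivial; prime⇒irreducible; euclidsLemma)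
open import Data.Nat.Properties
open import Algebra.Properties.CommutativeSemigroup +-commutativeSemigroup using (interchange)
import Data.Nat.Tactic.RingSolver as ℕ-Ring
open import Data.Product using (∃; ∃₂; _,_; uncurry)
open import Data.Sum using (inj₁; inj₂)
open import Data.Vec using ([]; _∷_)
import Data.Vec.Relation.Unary.All as VAll
open import Function using (_∘_)
open import Induction.WellFounded using (Acc; acc)
open import Relation.Binary.PropositionalEquality
open import Relation.Nullary using (Dec; yes; no; ¬_; contradiction)
open import Relation.Nullary.Decidable using (_×-dec_)

∑< : ℕ → (ℕ → ℕ) → ℕ
∑< zero    f = 0
∑< (suc n) f = f 0 + ∑< n (f ∘ suc)

syntax ∑< n (λ i → e) = ∑[ i < n ] e

∑-cong : ∀ n {f g : ℕ → ℕ} → (∀ i → f i ≡ g i) → ∑< n f ≡ ∑< n g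
∑-cong zero    f≗g = refl
∑-cong (suc n) f≗g = cong₂ _+_ (f≗g 0) (∑-cong n (f≗g ∘ suc))

∑-mono-≤ : ∀ n {f g : ℕ → ℕ} → (∀ i → f i ≤ g i) → ∑< n f ≤ ∑< n g
∑-mono-≤ zero    f≤g = z≤n
∑-mono-≤ (suc n) f≤g = +-mono-≤ (f≤g 0) (∑-mono-≤ n (f≤g ∘ suc))

∑-zero : ∀ n (f : ℕ → ℕ) → (∀ i → i < n → f i ≡ 0) → ∑< n f ≡ 0
∑-zero zero    f f≡0 = refl
∑-zero (suc n) f f≡0 =
  cong₂ _+_ (f≡0 0 (s≤s z≤n)) (∑-zero n (f ∘ suc) (λ i i<n → f≡0 (suc i) (s≤s i<n)))

∑-const : ∀ n c → ∑[ i < n ] c ≡ n * c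
∑-const zero    c = refl
∑-const (suc n) c = cong (_+_ c) (∑-const n c)

∑-distrib-+ : ∀ n (f g : ℕ → ℕ) → ∑[ i < n ] (f i + g i) ≡ ∑< n f + ∑< n g
∑-distrib-+ zero    f g = refl
∑-distrib-+ (suc n) f g =
  trans (cong (_+_ (f 0 + g 0)) (∑-distrib-+ n (f ∘ suc) (g ∘ suc))) (interchange (f 0) (g 0) _ _)

∑-distribʳ-* : ∀ n (f : ℕ → ℕ) c → ∑[ i < n ] (f i * c) ≡ ∑< n f * c
∑-distribʳ-* zero    f c = refl
∑-distribʳ-* (suc n) f c =
  trans (cong (_+_ (f 0 * c)) (∑-distribʳ-* n (f ∘ suc) c)) (sym (*-distribʳ-+ c (f 0) _))

∑-split : ∀ m n (f : ℕ → ℕ) → ∑< (m + n) f ≡ ∑< m f + ∑[ i < n ] f (m + i)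
∑-split zero    n f = refl
∑-split (suc m) n f = trans (cong (_+_ (f 0)) (∑-split m n (f ∘ suc))) (sym (+-assoc (f 0) _ _))

∑-snoc : ∀ n (f : ℕ → ℕ) → ∑< (suc n) f ≡ ∑< n f + f n
∑-snoc n f = begin
  ∑< (suc n) f                 ≡⟨ cong (λ k → ∑< k f) (+-comm 1 n) ⟩
  ∑< (n + 1) f                 ≡⟨ ∑-split n 1 f ⟩
  ∑< n f + (f (n + 0) + 0)     ≡⟨ cong (λ k → ∑< n f + k) (trans (+-identityʳ _) (cong f (+-identityʳ n))) ⟩
  ∑< n f + f n                 ∎
  where open ≡-Reasoning

∑-rotate : ∀ n (f : ℕ → ℕ) → f n ≡ f 0 → ∑[ i < n ] f (suc i) ≡ ∑< n f
∑-rotate n f fn≡f0 = +-cancelˡ-≡ (f 0) _ _ (begin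
  ∑< (suc n) f    ≡⟨ ∑-snoc n f ⟩
  ∑< n f + f n    ≡⟨ cong (_+_ (∑< n f)) fn≡f0 ⟩
  ∑< n f + f 0    ≡⟨ +-comm (∑< n f) (f 0) ⟩
  f 0 + ∑< n f    ∎)
  where open ≡-Reasoning

∑-blocks : ∀ q m (f : ℕ → ℕ) → ∑< (q * m) f ≡ ∑[ k < q ] ∑[ i < m ] f (k * m + i)
∑-blocks zero    m f = refl
∑-blocks (suc q) m f = begin
  ∑< (m + q * m) f
    ≡⟨ ∑-split m (q * m) f ⟩
  ∑< m f + ∑[ j < q * m ] f (m + j)
    ≡⟨ cong (_+_ (∑< m f)) (∑-blocks q m (λ j → f (m + j))) ⟩
  ∑< m f + ∑[ k < q ] ∑[ i < m ] f (m + (k * m + i))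
    ≡⟨ cong (_+_ (∑< m f)) (∑-cong q λ k → ∑-cong m λ i → cong f (sym (+-assoc m (k * m) i))) ⟩
  ∑< m f + ∑[ k < q ] ∑[ i < m ] f (suc k * m + i)
    ∎
  where open ≡-Reasoning

∣-diff-sym : ∀ {k z z′} → k ∣ℤ z -ℤ z′ → k ∣ℤ z′ -ℤ z
∣-diff-sym {z = z} {z′} k∣z-z′ = subst (_ ∣ℤ_) (negate-diff z z′) (ℤ∣.∣m⇒∣-m k∣z-z′)
  where
  negate-diff : ∀ z z′ → -ℤ (z -ℤ z′) ≡ z′ -ℤ z
  negate-diff = solve-∀

Periodic : ℕ → (ℤ → ℕ) → Set
Periodic m f = ∀ z z′ → + m ∣ℤ z -ℤ z′ → f z ≡ f z′

periodic-translate : ∀ {m f} → Periodic m f → ∀ c → Periodic m (λ z → f (z +ℤ c))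
periodic-translate f-per c z z′ m∣z-z′ = f-per _ _ (subst (_ ∣ℤ_) (shift-diff z z′ c) m∣z-z′)
  where
  shift-diff : ∀ z z′ c → z -ℤ z′ ≡ (z +ℤ c) -ℤ (z′ +ℤ c)
  shift-diff = solve-∀

periodic-scale : ∀ {m f} → Periodic m f → ∀ c → Periodic m (λ z → f (c *ℤ z))
periodic-scale f-per c z z′ m∣z-z′ =
  f-per _ _ (subst (_ ∣ℤ_) (scale-diff c z z′) (ℤ∣.∣n⇒∣m*n c m∣z-z′))
  where
  scale-diff : ∀ c z z′ → c *ℤ (z -ℤ z′) ≡ c *ℤ z -ℤ c *ℤ z′
  scale-diff = solve-∀

periodic-+-multiple : ∀ {m f} → Periodic m f → ∀ z q → f (z +ℤ q *ℤ + m) ≡ f z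
periodic-+-multiple {m} f-per z q = f-per _ _ (ℤ∣.divides q (add-sub z (q *ℤ + m)))
  where
  add-sub : ∀ z w → (z +ℤ w) -ℤ z ≡ w
  add-sub = solve-∀

∑-periodic-shift : ∀ m .{{_ : NonZero m}} {f} → Periodic m f → ∀ z →
                   ∑[ t < m ] f (z +ℤ + t) ≡ ∑[ t < m ] f (+ t)
∑-periodic-shift m {f} f-per z = begin
  ∑[ t < m ] f (z +ℤ + t)
    ≡⟨ ∑-cong m (λ t → cong (λ w → f (w +ℤ + t)) (a≡a%ℕn+[a/ℕn]*n z m)) ⟩
  ∑[ t < m ] f ((+ k +ℤ q *ℤ + m) +ℤ + t)
    ≡⟨ ∑-cong m (λ t → trans (cong f (swap (+ k) (q *ℤ + m) (+ t))) (periodic-+-multiple f-per (+ (k + t)) q)) ⟩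
  ∑[ t < m ] f (+ (k + t))
    ≡⟨ ∑-shiftℕ k ⟩
  ∑[ t < m ] f (+ t)
    ∎
  where
  open ≡-Reasoning
  k = z %ℕ m
  q = z /ℕ m
  swap : ∀ a b c → (a +ℤ b) +ℤ c ≡ (a +ℤ c) +ℤ b
  swap = solve-∀
  ∑-shiftℕ : ∀ k → ∑[ t < m ] f (+ (k + t)) ≡ ∑[ t < m ] f (+ t)
  ∑-shiftℕ zero    = refl
  ∑-shiftℕ (suc k) = begin
    ∑[ t < m ] f (+ (suc k + t))   ≡⟨ ∑-cong m (λ t → cong (f ∘ +_) (sym (+-suc k t))) ⟩
    ∑[ t < m ] f (+ (k + suc t))   ≡⟨ ∑-rotate m (λ t → f (+ (k + t))) period-step ⟩
    ∑[ t < m ] f (+ (k + t))       ≡⟨ ∑-shiftℕ k ⟩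
    ∑[ t < m ] f (+ t)             ∎
    where
    period-step : f (+ (k + m)) ≡ f (+ (k + 0))
    period-step = begin
      f (+ k +ℤ + m)          ≡⟨ cong (f ∘ (+ k +ℤ_)) (ℤP.*-identityˡ (+ m)) ⟨
      f (+ k +ℤ + 1 *ℤ + m)   ≡⟨ periodic-+-multiple f-per (+ k) (+ 1) ⟩
      f (+ k)                 ≡⟨ cong (f ∘ +_) (+-identityʳ k) ⟨
      f (+ (k + 0))           ∎

∑-periodic : ∀ m .{{_ : NonZero m}} {f} → Periodic m f → ∀ q →
             ∑[ j < q * m ] f (+ j) ≡ q * ∑[ t < m ] f (+ t)
∑-periodic m {f} f-per q = begin
  ∑[ j < q * m ] f (+ j)                       ≡⟨ ∑-blocks q m (f ∘ +_) ⟩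
  ∑[ k < q ] ∑[ t < m ] f (+ (k * m) +ℤ + t)   ≡⟨ ∑-cong q (λ k → ∑-periodic-shift m f-per (+ (k * m))) ⟩
  ∑[ k < q ] ∑[ t < m ] f (+ t)                ≡⟨ ∑-const q _ ⟩
  q * ∑[ t < m ] f (+ t)                       ∎
  where open ≡-Reasoning

𝟙 : {P : Set} → Dec P → ℕ
𝟙 (yes _) = 1
𝟙 (no _)  = 0

𝟙≤1 : {P : Set} (p? : Dec P) → 𝟙 p? ≤ 1
𝟙≤1 (yes _) = s≤s z≤n
𝟙≤1 (no _)  = z≤n

𝟙-yes : {P : Set} (p? : Dec P) → P → 𝟙 p? ≡ 1
𝟙-yes (yes _) _ = refl
𝟙-yes (no ¬p) p = contradiction p ¬p

𝟙-no : {P : Set} (p? : Dec P) → ¬ P → 𝟙 p? ≡ 0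
𝟙-no (yes p) ¬p = contradiction p ¬p
𝟙-no (no _)  _  = refl

𝟙-mono : {P Q : Set} → (P → Q) → (p? : Dec P) (q? : Dec Q) → 𝟙 p? ≤ 𝟙 q?
𝟙-mono P⇒Q (yes p) q?     = ≤-reflexive (sym (𝟙-yes q? (P⇒Q p)))
𝟙-mono P⇒Q (no _)  q?     = z≤n

𝟙-cong : {P Q : Set} → (P → Q) → (Q → P) → (p? : Dec P) (q? : Dec Q) → 𝟙 p? ≡ 𝟙 q?
𝟙-cong P⇒Q Q⇒P p? q? = ≤-antisym (𝟙-mono P⇒Q p? q?) (𝟙-mono Q⇒P q? p?)

𝟙-× : {P Q : Set} (p? : Dec P) (q? : Dec Q) → 𝟙 (p? ×-dec q?) ≡ 𝟙 p? * 𝟙 q?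
𝟙-× (yes _) (yes _) = refl
𝟙-× (yes _) (no _)  = refl
𝟙-× (no _)  _       = refl

𝟙-*-cong : {P : Set} (p? : Dec P) {a b : ℕ} → (P → a ≡ b) → 𝟙 p? * a ≡ 𝟙 p? * b
𝟙-*-cong (yes p) P⇒a≡b = cong (1 *_) (P⇒a≡b p)
𝟙-*-cong (no _)  _     = refl

𝟙-split-≤ : {P : Set} (p? : Dec P) {x y : ℕ} → x ≤ 1 → (¬ P → x ≤ y) → x ≤ 𝟙 p? + y
𝟙-split-≤ (yes _)  x≤1 _      = ≤-trans x≤1 (s≤s z≤n)
𝟙-split-≤ (no ¬p)  _   ¬P⇒x≤y = ¬P⇒x≤y ¬p

indicator-*-≤ : ∀ {a b x y c} → a ≤ 1 → a ≤ b → x ≤ c + y → a * x ≤ c + b * y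
indicator-*-≤ {zero}                         _ _   _       = z≤n
indicator-*-≤ {suc zero} {suc b} {x} {y} {c} _ _   x≤c+y = begin
  1 * x          ≡⟨ *-identityˡ x ⟩
  x              ≤⟨ x≤c+y ⟩
  c + y          ≤⟨ +-monoʳ-≤ c (m≤m+n y (b * y)) ⟩
  c + suc b * y  ∎
  where open ≤-Reasoning
indicator-*-≤ {suc (suc _)} (s≤s ()) _ _

𝟙∣ : ℕ → ℤ → ℕ
𝟙∣ m z = 𝟙 (+ m ℤ∣.∣? z)

𝟙∣-periodic : ∀ m → Periodic m (𝟙∣ m)
𝟙∣-periodic m z z′ m∣z-z′ = 𝟙-cong
  (λ m∣z  → subst (_ ∣ℤ_) (sub-diff z z′) (ℤ∣.∣m∣n⇒∣m-n m∣z m∣z-z′))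
  (λ m∣z′ → subst (_ ∣ℤ_) (add-diff z z′) (ℤ∣.∣m∣n⇒∣m+n m∣z′ m∣z-z′))
  (+ m ℤ∣.∣? z) (+ m ℤ∣.∣? z′)
  where
  sub-diff : ∀ z z′ → z -ℤ (z -ℤ z′) ≡ z′
  sub-diff = solve-∀
  add-diff : ∀ z z′ → z′ +ℤ (z -ℤ z′) ≡ z
  add-diff = solve-∀

∑-𝟙∣ : ∀ m .{{_ : NonZero m}} → ∑[ t < m ] 𝟙∣ m (+ t) ≡ 1
∑-𝟙∣ (suc m) = cong₂ _+_
  (𝟙-yes (+ suc m ℤ∣.∣? + 0) (ℤ∣.divides (+ 0) refl))
  (∑-zero m _ λ t t<m →
     𝟙-no (+ suc m ℤ∣.∣? + suc t) (λ m∣t → <⇒≱ (s≤s t<m) (ℕ∣.∣⇒≤ (ℤ∣.∣⇒∣ᵤ m∣t))))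

∑-𝟙∣-multiple : ∀ m c .{{_ : NonZero m}} .{{_ : NonZero c}} → ∑[ t < m ] 𝟙∣ m (+ c *ℤ + t) ≤ c
∑-𝟙∣-multiple m c@(suc _) = begin
  ∑[ t < m ] 𝟙∣ m (+ c *ℤ + t)            ≡⟨ ∑-cong m (λ t → cong (𝟙∣ m) (ℤP.pos-* c t)) ⟨
  ∑[ t < m ] g (c * t)                    ≡⟨ ∑-cong m (λ t → cong g (+-identityʳ (c * t))) ⟨
  ∑[ t < m ] g (c * t + 0)                ≤⟨ ∑-mono-≤ m (λ t → m≤m+n (g (c * t + 0)) _) ⟩
  ∑[ t < m ] ∑[ i < c ] g (c * t + i)     ≡⟨ ∑-cong m (λ t → ∑-cong c λ i → cong (λ u → g (u + i)) (*-comm c t)) ⟩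
  ∑[ t < m ] ∑[ i < c ] g (t * c + i)     ≡⟨ ∑-blocks m c g ⟨
  ∑< (m * c) g                            ≡⟨ cong (λ n → ∑< n g) (*-comm m c) ⟩
  ∑< (c * m) g                            ≡⟨ ∑-periodic m (𝟙∣-periodic m) c ⟩
  c * ∑< m g                              ≡⟨ cong (c *_) (∑-𝟙∣ m) ⟩
  c * 1                                   ≡⟨ *-identityʳ c ⟩
  c                                       ∎
  where
  open ≤-Reasoning
  g : ℕ → ℕ
  g u = 𝟙∣ m (+ u)

∑-select : ∀ m .{{_ : NonZero m}} {G} → Periodic m G → ∀ c →
           ∑[ y < m ] (𝟙∣ m (+ y -ℤ c) * G (+ y)) ≡ G c
∑-select m {G} G-per c = begin
  ∑[ y < m ] (𝟙∣ m (+ y -ℤ c) * G (+ y))   ≡⟨ ∑-cong m (λ y → 𝟙-*-cong (_ ℤ∣.∣? _) (G-per (+ y) c)) ⟩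
  ∑[ y < m ] (𝟙∣ m (+ y -ℤ c) * G c)       ≡⟨ ∑-distribʳ-* m _ (G c) ⟩
  ∑[ y < m ] 𝟙∣ m (+ y -ℤ c) * G c         ≡⟨ cong (_* G c) hits ⟩
  1 * G c                                  ≡⟨ *-identityˡ (G c) ⟩
  G c                                      ∎
  where
  open ≡-Reasoning
  cancel : ∀ c y → (c +ℤ y) -ℤ c ≡ y
  cancel = solve-∀
  hits : ∑[ y < m ] 𝟙∣ m (+ y -ℤ c) ≡ 1
  hits = begin
    ∑[ y < m ] 𝟙∣ m (+ y -ℤ c)
      ≡⟨ ∑-periodic-shift m (periodic-translate (𝟙∣-periodic m) (-ℤ c)) c ⟨
    ∑[ y < m ] 𝟙∣ m ((c +ℤ + y) -ℤ c)
      ≡⟨ ∑-cong m (λ y → cong (𝟙∣ m) (cancel c (+ y))) ⟩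
    ∑[ y < m ] 𝟙∣ m (+ y)
      ≡⟨ ∑-𝟙∣ m ⟩
    1
      ∎

SquareMod : ℕ → ℤ → Set
SquareMod m z = ∃ λ x → + m ∣ℤ x *ℤ x -ℤ z

-- IsSquareMod m s and isSquareMod? m s are definitionally IsSquareModℤ m (+ toℕ s) and
-- isSquareModℤ? m (+ toℕ s).
IsSquareModℤ : ℕ → ℤ → Set
IsSquareModℤ m z = ∃ λ (x : Fin m) → + (toℕ x * toℕ x) ≡ z [mod m ]

isSquareModℤ? : ∀ m z → Dec (IsSquareModℤ m z)
isSquareModℤ? m z = any? λ x → + (toℕ x * toℕ x) ≡? z [mod m ]

𝟙-square : ℕ → ℤ → ℕ
𝟙-square m z = 𝟙 (isSquareModℤ? m z)

root-congruent : ∀ {m x y z} → + m ∣ℤ x -ℤ y → + m ∣ℤ x *ℤ x -ℤ z → + m ∣ℤ y *ℤ y -ℤ z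
root-congruent {m} {x} {y} {z} m∣x-y m∣x²-z =
  subst (_ ∣ℤ_) (difference-of-squares x y z)
        (ℤ∣.∣m∣n⇒∣m-n m∣x²-z (ℤ∣.∣m⇒∣m*n (x +ℤ y) m∣x-y))
  where
  difference-of-squares : ∀ x y z → (x *ℤ x -ℤ z) -ℤ (x -ℤ y) *ℤ (x +ℤ y) ≡ y *ℤ y -ℤ z
  difference-of-squares = solve-∀

isSquareModℤ⇒squareMod : ∀ {m z} → IsSquareModℤ m z → SquareMod m z
isSquareModℤ⇒squareMod {m} {z} (x , x²≡z) =
  + toℕ x , subst (λ w → + m ∣ℤ w -ℤ z) (ℤP.pos-* (toℕ x) (toℕ x)) (ℤ∣.∣ᵤ⇒∣ x²≡z)

squareMod⇒isSquareModℤ : ∀ {m z} .{{_ : NonZero m}} → SquareMod m z → IsSquareModℤ m z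
squareMod⇒isSquareModℤ {m} {z} (x , m∣x²-z) =
  r̂ , ℤ∣.∣⇒∣ᵤ (subst (λ w → + m ∣ℤ w -ℤ z) r²≡ (root-congruent {x = x} m∣x-r m∣x²-z))
  where
  r = x %ℕ m
  r̂ : Fin m
  r̂ = fromℕ< (n%ℕd<d x m)
  r²≡ : + r *ℤ + r ≡ + (toℕ r̂ * toℕ r̂)
  r²≡ = trans (sym (ℤP.pos-* r r)) (cong (λ k → + (k * k)) (sym (toℕ-fromℕ< (n%ℕd<d x m))))
  m∣x-r : + m ∣ℤ x -ℤ + r
  m∣x-r = ℤ∣.divides (x /ℕ m) (trans (cong (_-ℤ + r) (a≡a%ℕn+[a/ℕn]*n x m)) (add-sub (+ r) _))
    where
    add-sub : ∀ a b → (a +ℤ b) -ℤ a ≡ b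
    add-sub = solve-∀

squareMod-translate : ∀ {m z z′} → + m ∣ℤ z -ℤ z′ → SquareMod m z → SquareMod m z′
squareMod-translate {z = z} {z′} m∣z-z′ (x , m∣x²-z) =
  x , subst (_ ∣ℤ_) (telescope (x *ℤ x) z z′) (ℤ∣.∣m∣n⇒∣m+n m∣x²-z m∣z-z′)
  where
  telescope : ∀ a z z′ → (a -ℤ z) +ℤ (z -ℤ z′) ≡ a -ℤ z′
  telescope = solve-∀

squareMod-∣ : ∀ {m n z} → + m ∣ℤ + n → SquareMod n z → SquareMod m z
squareMod-∣ m∣n (x , n∣x²-z) = x , ℤ∣.∣-trans m∣n n∣x²-z

𝟙-square-mono : ∀ {m n z w} .{{_ : NonZero n}} →
                (SquareMod m z → SquareMod n w) → 𝟙-square m z ≤ 𝟙-square n w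
𝟙-square-mono {m} {n} {z} {w} sq⇒sq =
  𝟙-mono (squareMod⇒isSquareModℤ ∘ sq⇒sq ∘ isSquareModℤ⇒squareMod) (isSquareModℤ? m z) (isSquareModℤ? n w)

𝟙-square-periodic : ∀ m .{{_ : NonZero m}} → Periodic m (𝟙-square m)
𝟙-square-periodic m z z′ m∣z-z′ =
  ≤-antisym (𝟙-square-mono (squareMod-translate {z = z} {z′} m∣z-z′))
            (𝟙-square-mono (squareMod-translate {z = z′} {z} (∣-diff-sym {z = z} m∣z-z′)))

𝟙-square-antitone : ∀ {m n} .{{_ : NonZero m}} → + m ∣ℤ + n → ∀ z → 𝟙-square n z ≤ 𝟙-square m z
𝟙-square-antitone m∣n z = 𝟙-square-mono {z = z} {w = z} (squareMod-∣ m∣n)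

^-monoʳ-∣ : ∀ p {i j} → i ≤ j → p ^ i ∣ p ^ j
^-monoʳ-∣ p {i} i≤j with m≤n⇒∃[o]m+o≡n i≤j
... | o , refl = ℕ∣.divides (p ^ o) (trans (^-distribˡ-+-* p i o) (*-comm (p ^ i) (p ^ o)))

factorOutPower : ∀ p .{{_ : NonTrivial p}} x .{{_ : NonZero x}} → ∃₂ λ w u → x ≡ p ^ w * u × ¬ p ∣ u
factorOutPower p x = go x (<-wellFounded x)
  where
  go : ∀ x .{{_ : NonZero x}} → Acc _<_ x → ∃₂ λ w u → x ≡ p ^ w * u × ¬ p ∣ u
  go x (acc rec) with p ℕ∣.∣? x
  ... | no p∤x = 0 , x , sym (+-identityʳ x) , p∤x
  ... | yes (ℕ∣.divides q refl)
    with go q {{m*n≢0⇒m≢0 q}} (rec (m<m*n q p {{m*n≢0⇒m≢0 q}} (nonTrivial⇒n>1 p)))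
  ...   | w , u , q≡pʷu , p∤u = suc w , u , trans (cong (_* p) q≡pʷu) (rotate (p ^ w) u p) , p∤u
    where
    rotate : ∀ a u p → a * u * p ≡ p * a * u
    rotate = ℕ-Ring.solve-∀

prime∤⇒coprime : ∀ {p n} → Prime p → ¬ p ∣ n → Coprime p n
prime∤⇒coprime pr p∤n (d∣p , d∣n) with prime⇒irreducible pr d∣p
... | inj₁ d≡1 = d≡1
... | inj₂ refl = contradiction d∣n p∤n

linear-congruence : ∀ {p v} → Prime p → ¬ p ∣ v → ∀ c → ∃ λ t → + p ∣ℤ c +ℤ + v *ℤ t
linear-congruence {p} {v} pr p∤v c with coprime-Bézout (prime∤⇒coprime pr p∤v)
... | Bézout.+- x y 1+yv≡xp = c *ℤ + y , ℤ∣.divides (c *ℤ + x) (begin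
  c +ℤ + v *ℤ (c *ℤ + y)     ≡⟨ factor c (+ v) (+ y) ⟩
  c *ℤ (+ 1 +ℤ + y *ℤ + v)   ≡⟨ cong (λ a → c *ℤ (+ 1 +ℤ a)) (ℤP.pos-* y v) ⟨
  c *ℤ + (1 + y * v)         ≡⟨ cong (λ a → c *ℤ + a) 1+yv≡xp ⟩
  c *ℤ + (x * p)             ≡⟨ cong (c *ℤ_) (ℤP.pos-* x p) ⟩
  c *ℤ (+ x *ℤ + p)          ≡⟨ ℤP.*-assoc c (+ x) (+ p) ⟨
  c *ℤ + x *ℤ + p            ∎)
  where
  open ≡-Reasoning
  factor : ∀ c v y → c +ℤ v *ℤ (c *ℤ y) ≡ c *ℤ (+ 1 +ℤ y *ℤ v)
  factor = solve-∀
... | Bézout.-+ x y 1+xp≡yv = -ℤ (c *ℤ + y) , ℤ∣.divides (-ℤ (c *ℤ + x)) (begin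
  c +ℤ + v *ℤ -ℤ (c *ℤ + y)       ≡⟨ factor c (+ v) (+ y) ⟩
  c -ℤ c *ℤ (+ y *ℤ + v)          ≡⟨ cong (λ a → c -ℤ c *ℤ a) (ℤP.pos-* y v) ⟨
  c -ℤ c *ℤ + (y * v)             ≡⟨ cong (λ a → c -ℤ c *ℤ + a) 1+xp≡yv ⟨
  c -ℤ c *ℤ (+ 1 +ℤ + (x * p))    ≡⟨ cong (λ a → c -ℤ c *ℤ (+ 1 +ℤ a)) (ℤP.pos-* x p) ⟩
  c -ℤ c *ℤ (+ 1 +ℤ + x *ℤ + p)   ≡⟨ cancel c (+ x) (+ p) ⟩
  -ℤ (c *ℤ + x) *ℤ + p            ∎)
  where
  open ≡-Reasoning
  factor : ∀ c v y → c +ℤ v *ℤ -ℤ (c *ℤ y) ≡ c -ℤ c *ℤ (y *ℤ v)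
  factor = solve-∀
  cancel : ∀ c x p → c -ℤ c *ℤ (+ 1 +ℤ x *ℤ p) ≡ -ℤ (c *ℤ x) *ℤ p
  cancel = solve-∀

-- If x² − s = cM then (x + Qt)² − s = (x² − s) + 2xQ·t + Q²t² ≡ (c + vt)M (mod pM), so t is
-- chosen with c + vt ≡ 0 (mod p).
squareMod-lift-step : ∀ {p M s} (x Q v : ℕ) → Prime p → + M ∣ℤ + x *ℤ + x -ℤ s →
                      2 * x * Q ≡ v * M → ¬ p ∣ v → p * M ∣ Q * Q → SquareMod (p * M) s
squareMod-lift-step {p} {M} {s} x Q v pr (ℤ∣.divides c x²-s≡cM) 2xQ≡vM p∤v pM∣Q²
  with linear-congruence pr p∤v c
... | t , ℤ∣.divides β c+vt≡βp = + x +ℤ + Q *ℤ t ,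
  subst (_ ∣ℤ_) (sym y²-s≡)
    (ℤ∣.∣m∣n⇒∣m+n
      (ℤ∣.divides β (trans (ℤP.*-assoc β (+ p) (+ M)) (cong (β *ℤ_) (sym (ℤP.pos-* p M)))))
      (ℤ∣.∣m⇒∣m*n (t *ℤ t) (subst (_ ∣ℤ_) (ℤP.pos-* Q Q) (ℤ∣.∣ᵤ⇒∣ pM∣Q²))))
  where
  open ≡-Reasoning
  expand : ∀ x q t s → (x +ℤ q *ℤ t) *ℤ (x +ℤ q *ℤ t) -ℤ s ≡
                       (x *ℤ x -ℤ s) +ℤ (+ 2 *ℤ x *ℤ q) *ℤ t +ℤ (q *ℤ q) *ℤ (t *ℤ t)
  expand = solve-∀
  collect : ∀ c m v t r → c *ℤ m +ℤ (v *ℤ m) *ℤ t +ℤ r ≡ (c +ℤ v *ℤ t) *ℤ m +ℤ r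
  collect = solve-∀
  2xQ≡vMℤ : + 2 *ℤ + x *ℤ + Q ≡ + v *ℤ + M
  2xQ≡vMℤ = begin
    + 2 *ℤ + x *ℤ + Q   ≡⟨ cong (_*ℤ + Q) (ℤP.pos-* 2 x) ⟨
    + (2 * x) *ℤ + Q    ≡⟨ ℤP.pos-* (2 * x) Q ⟨
    + (2 * x * Q)       ≡⟨ cong +_ 2xQ≡vM ⟩
    + (v * M)           ≡⟨ ℤP.pos-* v M ⟩
    + v *ℤ + M          ∎
  y²-s≡ : (+ x +ℤ + Q *ℤ t) *ℤ (+ x +ℤ + Q *ℤ t) -ℤ s ≡
          β *ℤ + p *ℤ + M +ℤ (+ Q *ℤ + Q) *ℤ (t *ℤ t)
  y²-s≡ = begin
    (+ x +ℤ + Q *ℤ t) *ℤ (+ x +ℤ + Q *ℤ t) -ℤ s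
      ≡⟨ expand (+ x) (+ Q) t s ⟩
    (+ x *ℤ + x -ℤ s) +ℤ (+ 2 *ℤ + x *ℤ + Q) *ℤ t +ℤ (+ Q *ℤ + Q) *ℤ (t *ℤ t)
      ≡⟨ cong₂ (λ a b → a +ℤ b *ℤ t +ℤ (+ Q *ℤ + Q) *ℤ (t *ℤ t)) x²-s≡cM 2xQ≡vMℤ ⟩
    c *ℤ + M +ℤ (+ v *ℤ + M) *ℤ t +ℤ (+ Q *ℤ + Q) *ℤ (t *ℤ t)
      ≡⟨ collect c (+ M) (+ v) t _ ⟩
    (c +ℤ + v *ℤ t) *ℤ + M +ℤ (+ Q *ℤ + Q) *ℤ (t *ℤ t)
      ≡⟨ cong (λ a → a *ℤ + M +ℤ (+ Q *ℤ + Q) *ℤ (t *ℤ t)) c+vt≡βp ⟩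
    β *ℤ + p *ℤ + M +ℤ (+ Q *ℤ + Q) *ℤ (t *ℤ t)
      ∎

p^2w∣[p^w*u]² : ∀ p w u → p ^ (w + w) ∣ (p ^ w * u) * (p ^ w * u)
p^2w∣[p^w*u]² p w u =
  ℕ∣.divides (u * u) (trans (rearrange (p ^ w) u) (cong (u * u *_) (sym (^-distribˡ-+-* p w w))))
  where
  rearrange : ∀ a u → (a * u) * (a * u) ≡ u * u * (a * a)
  rearrange = ℕ-Ring.solve-∀

squareMod-lift-odd : ∀ {p k s} w u → Prime p → p ≢ 2 → ¬ p ∣ u → suc (w + w) ≤ k →
                     + (p ^ k) ∣ℤ + (p ^ w * u) *ℤ + (p ^ w * u) -ℤ s → SquareMod (p ^ suc k) s
squareMod-lift-odd {p} {k} {s} w u pr p≢2 p∤u 2w<k pᵏ∣x²-s with m≤n⇒∃[o]m+o≡n 2w<k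
... | e , refl = squareMod-lift-step (p ^ w * u) (p * p ^ w * p ^ e) (2 * u) pr pᵏ∣x²-s
                   (trans (2xQ p (p ^ w) (p ^ e) u) (cong (2 * u *_) (sym pᵏ≡)))
                   p∤2u
                   (ℕ∣.divides (p ^ e) (trans (Q² p (p ^ w) (p ^ e)) (cong (λ a → p ^ e * (p * a)) (sym pᵏ≡))))
  where
  pᵏ≡ : p ^ (suc (w + w) + e) ≡ p * (p ^ w * p ^ w) * p ^ e
  pᵏ≡ = trans (^-distribˡ-+-* p (suc (w + w)) e) (cong (λ a → p * a * p ^ e) (^-distribˡ-+-* p w w))
  2xQ : ∀ p a b u → 2 * (a * u) * (p * a * b) ≡ 2 * u * (p * (a * a) * b)
  2xQ = ℕ-Ring.solve-∀
  Q² : ∀ p a b → (p * a * b) * (p * a * b) ≡ b * (p * (p * (a * a) * b))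
  Q² = ℕ-Ring.solve-∀
  p∤2u : ¬ p ∣ 2 * u
  p∤2u p∣2u with euclidsLemma 2 u pr p∣2u
  ... | inj₁ p∣2 = p≢2 (≤-antisym (ℕ∣.∣⇒≤ p∣2) (nonTrivial⇒n>1 p {{prime⇒nonTrivial pr}}))
  ... | inj₂ p∣u = p∤u p∣u

squareMod-lift-even : ∀ {k s} w u → ¬ 2 ∣ u → 3 + (w + w) ≤ k →
                      + (2 ^ k) ∣ℤ + (2 ^ w * u) *ℤ + (2 ^ w * u) -ℤ s → SquareMod (2 ^ suc k) s
squareMod-lift-even {k} {s} w u 2∤u 2w+2<k 2ᵏ∣x²-s with m≤n⇒∃[o]m+o≡n 2w+2<k
... | e , refl = squareMod-lift-step (2 ^ w * u) (4 * 2 ^ w * 2 ^ e) u prime[2] 2ᵏ∣x²-s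
                   (trans (2xQ (2 ^ w) (2 ^ e) u) (cong (u *_) (sym 2ᵏ≡)))
                   2∤u
                   (ℕ∣.divides (2 ^ e) (trans (Q² (2 ^ w) (2 ^ e)) (cong (λ a → 2 ^ e * (2 * a)) (sym 2ᵏ≡))))
  where
  2ᵏ≡ : 2 ^ (3 + (w + w) + e) ≡ 2 * (2 * (2 * (2 ^ w * 2 ^ w))) * 2 ^ e
  2ᵏ≡ = trans (^-distribˡ-+-* 2 (3 + (w + w)) e)
              (cong (λ a → 2 * (2 * (2 * a)) * 2 ^ e) (^-distribˡ-+-* 2 w w))
  2xQ : ∀ a b u → 2 * (a * u) * (4 * a * b) ≡ u * (2 * (2 * (2 * (a * a))) * b)
  2xQ = ℕ-Ring.solve-∀
  Q² : ∀ a b → (4 * a * b) * (4 * a * b) ≡ b * (2 * (2 * (2 * (2 * (a * a))) * b))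
  Q² = ℕ-Ring.solve-∀

+∣i∣*+∣i∣≡i*i : ∀ i → + ∣ i ∣ *ℤ + ∣ i ∣ ≡ i *ℤ i
+∣i∣*+∣i∣≡i*i (+ n)    = refl
+∣i∣*+∣i∣≡i*i -[1+ n ] = refl

∤4s⇒∤4x² : ∀ {M s} x → + M ∣ℤ + x *ℤ + x -ℤ s → ¬ (+ M ∣ℤ + 4 *ℤ s) → ¬ M ∣ 4 * (x * x)
∤4s⇒∤4x² {M} {s} x M∣x²-s M∤4s M∣4x² = M∤4s (subst (_ ∣ℤ_) (cancel (+ x *ℤ + x) s)
  (ℤ∣.∣m∣n⇒∣m-n (subst (_ ∣ℤ_) 4x²≡ (ℤ∣.∣ᵤ⇒∣ M∣4x²)) (ℤ∣.∣n⇒∣m*n (+ 4) M∣x²-s)))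
  where
  cancel : ∀ a s → + 4 *ℤ a -ℤ + 4 *ℤ (a -ℤ s) ≡ + 4 *ℤ s
  cancel = solve-∀
  4x²≡ : + (4 * (x * x)) ≡ + 4 *ℤ (+ x *ℤ + x)
  4x²≡ = trans (ℤP.pos-* 4 (x * x)) (cong (+ 4 *ℤ_) (ℤP.pos-* x x))

-- Write a root as p^w u with p ∤ u. As p^k ∤ 4x², k exceeds 2w (2w + 2 if p = 2), which leaves
-- room for a lifting step.
squareMod-lift : ∀ {p k s} → Prime p → SquareMod (p ^ k) s → ¬ (+ (p ^ k) ∣ℤ + 4 *ℤ s) →
                 SquareMod (p ^ suc k) s
squareMod-lift {p} {k} {s} pr (x , pᵏ∣x²-s) pᵏ∤4s =
  lift-ℕ-root ∣ x ∣ (subst (λ a → + (p ^ k) ∣ℤ a -ℤ s) (sym (+∣i∣*+∣i∣≡i*i x)) pᵏ∣x²-s)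
  where
  instance
    p-nonTrivial : NonTrivial p
    p-nonTrivial = prime⇒nonTrivial pr
  above : ∀ {j} x → + (p ^ k) ∣ℤ + x *ℤ + x -ℤ s → (k ≤ j → p ^ k ∣ 4 * (x * x)) → j < k
  above x pᵏ∣x²-s k≤j⇒pᵏ∣4x² = ≰⇒> (∤4s⇒∤4x² x pᵏ∣x²-s pᵏ∤4s ∘ k≤j⇒pᵏ∣4x²)
  lift-p-adic : ∀ w u → ¬ p ∣ u → + (p ^ k) ∣ℤ + (p ^ w * u) *ℤ + (p ^ w * u) -ℤ s → SquareMod (p ^ suc k) s
  lift-p-adic w u p∤u pᵏ∣x²-s with p ≟ 2
  ... | yes refl = squareMod-lift-even w u p∤u (above (p ^ w * u) pᵏ∣x²-s λ k≤2+2w →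
          ℕ∣.∣-trans (^-monoʳ-∣ 2 k≤2+2w)
                     (subst (_∣ 4 * ((2 ^ w * u) * (2 ^ w * u))) (*-assoc 2 2 (2 ^ (w + w)))
                            (ℕ∣.*-monoʳ-∣ 4 (p^2w∣[p^w*u]² 2 w u))))
        pᵏ∣x²-s
  ... | no p≢2 = squareMod-lift-odd w u pr p≢2 p∤u (above (p ^ w * u) pᵏ∣x²-s λ k≤2w →
          ℕ∣.∣-trans (^-monoʳ-∣ p k≤2w) (ℕ∣.∣-trans (p^2w∣[p^w*u]² p w u) (ℕ∣.n∣m*n 4)))
        pᵏ∣x²-s
  lift-ℕ-root : ∀ n → + (p ^ k) ∣ℤ + n *ℤ + n -ℤ s → SquareMod (p ^ suc k) s
  lift-ℕ-root zero    pᵏ∣0-s = contradiction (ℕ∣._∣0 (p ^ k)) (∤4s⇒∤4x² 0 pᵏ∣0-s pᵏ∤4s)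
  lift-ℕ-root n@(suc _) pᵏ∣n²-s with factorOutPower p n
  ... | w , u , n≡pʷu , p∤u =
    lift-p-adic w u p∤u (subst (λ a → + (p ^ k) ∣ℤ + a *ℤ + a -ℤ s) n≡pʷu pᵏ∣n²-s)

squareMod-lift* : ∀ {p a b s} → Prime p → a ≤ b → SquareMod (p ^ a) s → ¬ (+ (p ^ a) ∣ℤ + 4 *ℤ s) →
                  SquareMod (p ^ b) s
squareMod-lift* {p} {a} {s = s} pr a≤b sq pᵃ∤4s = go (≤⇒≤′ a≤b)
  where
  go : ∀ {b} → a ≤′ b → SquareMod (p ^ b) s
  go ≤′-refl        = sq
  go (≤′-step {b} a≤′b) =
    squareMod-lift {k = b} pr (go a≤′b) (pᵃ∤4s ∘ ℤ∣.∣-trans (ℤ∣.∣ᵤ⇒∣ (^-monoʳ-∣ p (≤′⇒≤ a≤′b))))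

𝟙-square-lift : ∀ {p a b} → Prime p → a ≤ b → ∀ z → ¬ (+ (p ^ a) ∣ℤ + 4 *ℤ z) →
                𝟙-square (p ^ a) z ≤ 𝟙-square (p ^ b) z
𝟙-square-lift {p} {a} {b} pr a≤b z pᵃ∤4z =
  𝟙-square-mono {{m^n≢0 p b {{prime⇒nonZero pr}}}} (λ sq → squareMod-lift* pr a≤b sq pᵃ∤4z)

𝟙-squareChain : ℕ → ∀ {n} → Vec ℤ n → ℤ → ℕ
𝟙-squareChain m []      z = 𝟙-square m z
𝟙-squareChain m (d ∷ h) z = 𝟙-square m z * 𝟙-squareChain m h (z +ℤ d)

-- The entries z of the chain with m ∣ 4z, where squareMod-lift does not apply.
obstructions : ℕ → ∀ {n} → Vec ℤ n → ℤ → ℕ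
obstructions m []      z = 𝟙∣ m (+ 4 *ℤ z)
obstructions m (d ∷ h) z = 𝟙∣ m (+ 4 *ℤ z) + obstructions m h (z +ℤ d)

𝟙-squareChain≤1 : ∀ m {n} (h : Vec ℤ n) z → 𝟙-squareChain m h z ≤ 1
𝟙-squareChain≤1 m []      z = 𝟙≤1 (isSquareModℤ? m z)
𝟙-squareChain≤1 m (d ∷ h) z = *-mono-≤ (𝟙≤1 (isSquareModℤ? m z)) (𝟙-squareChain≤1 m h (z +ℤ d))

𝟙-squareChain-periodic : ∀ m .{{_ : NonZero m}} {n} (h : Vec ℤ n) → Periodic m (𝟙-squareChain m h)
𝟙-squareChain-periodic m []      = 𝟙-square-periodic m
𝟙-squareChain-periodic m (d ∷ h) z z′ m∣z-z′ = cong₂ _*_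
  (𝟙-square-periodic m z z′ m∣z-z′)
  (periodic-translate (𝟙-squareChain-periodic m h) d z z′ m∣z-z′)

obstructions-periodic : ∀ m {n} (h : Vec ℤ n) → Periodic m (obstructions m h)
obstructions-periodic m []      = periodic-scale (𝟙∣-periodic m) (+ 4)
obstructions-periodic m (d ∷ h) z z′ m∣z-z′ = cong₂ _+_
  (periodic-scale (𝟙∣-periodic m) (+ 4) z z′ m∣z-z′)
  (periodic-translate (obstructions-periodic m h) d z z′ m∣z-z′)

∑-obstructions : ∀ m .{{_ : NonZero m}} {n} (h : Vec ℤ n) → ∑[ t < m ] obstructions m h (+ t) ≤ 4 * suc n
∑-obstructions m []      = ∑-𝟙∣-multiple m 4
∑-obstructions m {suc n} (d ∷ h) = begin
  ∑[ t < m ] (𝟙∣ m (+ 4 *ℤ + t) + obstructions m h (+ t +ℤ d))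
    ≡⟨ ∑-distrib-+ m _ _ ⟩
  ∑[ t < m ] 𝟙∣ m (+ 4 *ℤ + t) + ∑[ t < m ] obstructions m h (+ t +ℤ d)
    ≡⟨ cong (_+_ (∑[ t < m ] 𝟙∣ m (+ 4 *ℤ + t)))
            (trans (∑-cong m (λ t → cong (obstructions m h) (ℤP.+-comm (+ t) d)))
                   (∑-periodic-shift m (obstructions-periodic m h) d)) ⟩
  ∑[ t < m ] 𝟙∣ m (+ 4 *ℤ + t) + ∑[ t < m ] obstructions m h (+ t)
    ≤⟨ +-mono-≤ (∑-𝟙∣-multiple m 4) (∑-obstructions m h) ⟩
  4 + 4 * suc n
    ≡⟨ *-suc 4 (suc n) ⟨
  4 * suc (suc n) ∎
  where open ≤-Reasoning

𝟙-squareChain-antitone : ∀ {m m′} .{{_ : NonZero m}} → + m ∣ℤ + m′ →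
                         ∀ {n} (h : Vec ℤ n) z → 𝟙-squareChain m′ h z ≤ 𝟙-squareChain m h z
𝟙-squareChain-antitone m∣m′ []      z = 𝟙-square-antitone m∣m′ z
𝟙-squareChain-antitone m∣m′ (d ∷ h) z =
  *-mono-≤ (𝟙-square-antitone m∣m′ z) (𝟙-squareChain-antitone m∣m′ h (z +ℤ d))

𝟙-squareChain-lift : ∀ {p a b} → Prime p → a ≤ b → ∀ {n} (h : Vec ℤ n) z →
                     𝟙-squareChain (p ^ a) h z ≤ obstructions (p ^ a) h z + 𝟙-squareChain (p ^ b) h z
𝟙-squareChain-lift {p} {a} {b} pr a≤b [] z =
  𝟙-split-≤ (+ (p ^ a) ℤ∣.∣? + 4 *ℤ z) (𝟙≤1 (isSquareModℤ? (p ^ a) z)) (𝟙-square-lift pr a≤b z)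
𝟙-squareChain-lift {p} {a} {b} pr a≤b (d ∷ h) z = begin
  𝟙-squareChain (p ^ a) (d ∷ h) z
    ≤⟨ 𝟙-split-≤ (+ (p ^ a) ℤ∣.∣? + 4 *ℤ z) (𝟙-squareChain≤1 (p ^ a) (d ∷ h) z) (λ pᵃ∤4z →
         indicator-*-≤ (𝟙≤1 (isSquareModℤ? (p ^ a) z)) (𝟙-square-lift pr a≤b z pᵃ∤4z)
                       (𝟙-squareChain-lift pr a≤b h (z +ℤ d))) ⟩
  𝟙∣ (p ^ a) (+ 4 *ℤ z) + (obstructions (p ^ a) h (z +ℤ d) + 𝟙-squareChain (p ^ b) (d ∷ h) z)
    ≡⟨ +-assoc (𝟙∣ (p ^ a) (+ 4 *ℤ z)) _ _ ⟨
  obstructions (p ^ a) (d ∷ h) z + 𝟙-squareChain (p ^ b) (d ∷ h) z ∎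
  where open ≤-Reasoning

length-filter≡sum-𝟙 : ∀ {A : Set} {P : A → Set} (P? : ∀ x → Dec (P x)) xs →
                      length (filter P? xs) ≡ sum (map (𝟙 ∘ P?) xs)
length-filter≡sum-𝟙 P? List.[] = refl
length-filter≡sum-𝟙 P? (x List.∷ xs) with P? x
... | yes _ = cong suc (length-filter≡sum-𝟙 P? xs)
... | no _  = length-filter≡sum-𝟙 P? xs

sum-map-++ : ∀ {A : Set} (f : A → ℕ) xs ys → sum (map f (xs ++ ys)) ≡ sum (map f xs) + sum (map f ys)
sum-map-++ f xs ys = trans (cong sum (List.map-++ f xs ys)) (sum-++ (map f xs) (map f ys))

sum-map-concatMap : ∀ {A B : Set} (f : B → ℕ) (g : A → List B) xs →
                    sum (map f (concatMap g xs)) ≡ sum (map (λ x → sum (map f (g x))) xs)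
sum-map-concatMap f g List.[]         = refl
sum-map-concatMap f g (x List.∷ xs) =
  trans (sum-map-++ f (g x) (concatMap g xs)) (cong (_+_ (sum (map f (g x)))) (sum-map-concatMap f g xs))

sum-map-*ˡ : ∀ {A : Set} c (f : A → ℕ) xs → sum (map (λ x → c * f x) xs) ≡ c * sum (map f xs)
sum-map-*ˡ c f List.[]         = sym (*-zeroʳ c)
sum-map-*ˡ c f (x List.∷ xs) = trans (cong (_+_ (c * f x)) (sum-map-*ˡ c f xs)) (sym (*-distribˡ-+ c (f x) _))

sum-tabulate : ∀ m (G : ℕ → ℕ) → sum (tabulate {n = m} (G ∘ toℕ)) ≡ ∑< m G
sum-tabulate zero    G = refl
sum-tabulate (suc m) G = cong (_+_ (G 0)) (sum-tabulate m (G ∘ suc))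

sum-allFin : ∀ m (G : ℕ → ℕ) → sum (map (G ∘ toℕ) (allFin m)) ≡ ∑< m G
sum-allFin m G = trans (cong sum (List.map-tabulate {n = m} (λ i → i) (G ∘ toℕ))) (sum-tabulate m G)

sum-allTuples-suc : ∀ m n (f : Vec (Fin m) (suc n) → ℕ) →
                    sum (map f (allTuples m (suc n))) ≡
                    sum (map (λ x → sum (map (f ∘ (x ∷_)) (allTuples m n))) (allFin m))
sum-allTuples-suc m n f = trans (sum-map-concatMap f _ (allFin m))
  (cong sum (List.map-cong (λ x → cong sum (sym (List.map-∘ (allTuples m n)))) (allFin m)))

𝟙-allSquares-∷ : ∀ m {n} (x : Fin m) (s : Vec (Fin m) n) →
                 𝟙 (VAll.all? (isSquareMod? m) (x ∷ s)) ≡ 𝟙-square m (+ toℕ x) * 𝟙 (VAll.all? (isSquareMod? m) s)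
𝟙-allSquares-∷ m x s =
  trans (𝟙-cong VAll.uncons (uncurry VAll._∷_) (VAll.all? (isSquareMod? m) (x ∷ s)) (x² ×-dec s²)) (𝟙-× x² s²)
  where
  x² = isSquareMod? m x
  s² = VAll.all? (isSquareMod? m) s

𝟙-≡mod : ∀ m a b → 𝟙 (a ≡? b [mod m ]) ≡ 𝟙∣ m (a -ℤ b)
𝟙-≡mod m a b = 𝟙-cong ℤ∣.∣ᵤ⇒∣ ℤ∣.∣⇒∣ᵤ (a ≡? b [mod m ]) (+ m ℤ∣.∣? (a -ℤ b))

𝟙-counted-[] : ∀ m (x : Fin m) → 𝟙 (counted? m {1} [] (x ∷ [])) ≡ 𝟙-square m (+ toℕ x)
𝟙-counted-[] m x = begin
  𝟙 (counted? m [] (x ∷ []))                    ≡⟨ 𝟙-× (VAll.all? (isSquareMod? m) (x ∷ [])) (chain? m (x ∷ []) []) ⟩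
  𝟙 (VAll.all? (isSquareMod? m) (x ∷ [])) * 1   ≡⟨ *-identityʳ _ ⟩
  𝟙 (VAll.all? (isSquareMod? m) (x ∷ []))       ≡⟨ 𝟙-allSquares-∷ m x [] ⟩
  𝟙-square m (+ toℕ x) * 1                     ≡⟨ *-identityʳ _ ⟩
  𝟙-square m (+ toℕ x)                         ∎
  where open ≡-Reasoning

𝟙-counted-∷∷ : ∀ m {n} d (h : Vec ℤ n) (x y : Fin m) (s : Vec (Fin m) n) →
  𝟙 (counted? m (d ∷ h) (x ∷ y ∷ s)) ≡
  𝟙-square m (+ toℕ x) * (𝟙∣ m (+ toℕ y -ℤ (+ toℕ x +ℤ d)) * 𝟙 (counted? m h (y ∷ s)))
𝟙-counted-∷∷ m d h x y s = begin
  𝟙 (counted? m (d ∷ h) (x ∷ y ∷ s))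
    ≡⟨ 𝟙-× (allSquares? (x ∷ y ∷ s)) (chain? m (x ∷ y ∷ s) (d ∷ h)) ⟩
  𝟙 (allSquares? (x ∷ y ∷ s)) * 𝟙 (step? ×-dec chain? m (y ∷ s) h)
    ≡⟨ cong₂ _*_ (𝟙-allSquares-∷ m x (y ∷ s)) (𝟙-× step? (chain? m (y ∷ s) h)) ⟩
  (𝟙-square m (+ toℕ x) * 𝟙 (allSquares? (y ∷ s))) * (𝟙 step? * 𝟙 (chain? m (y ∷ s) h))
    ≡⟨ rearrange (𝟙-square m (+ toℕ x)) (𝟙 (allSquares? (y ∷ s))) (𝟙 step?) (𝟙 (chain? m (y ∷ s) h)) ⟩
  𝟙-square m (+ toℕ x) * (𝟙 step? * (𝟙 (allSquares? (y ∷ s)) * 𝟙 (chain? m (y ∷ s) h)))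
    ≡⟨ cong₂ (λ a b → 𝟙-square m (+ toℕ x) * (a * b))
             (trans (𝟙-≡mod m (+ toℕ y -ℤ + toℕ x) d) (cong (𝟙∣ m) (regroup (+ toℕ y) (+ toℕ x) d)))
             (sym (𝟙-× (allSquares? (y ∷ s)) (chain? m (y ∷ s) h))) ⟩
  𝟙-square m (+ toℕ x) * (𝟙∣ m (+ toℕ y -ℤ (+ toℕ x +ℤ d)) * 𝟙 (counted? m h (y ∷ s)))
    ∎
  where
  open ≡-Reasoning
  allSquares? : ∀ {k} (v : Vec (Fin m) k) → Dec (VAll.All (IsSquareMod m) v)
  allSquares? = VAll.all? (isSquareMod? m)
  step? : Dec (+ toℕ y -ℤ + toℕ x ≡ d [mod m ])
  step? = + toℕ y -ℤ + toℕ x ≡? d [mod m ]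
  rearrange : ∀ a b c e → (a * b) * (c * e) ≡ a * (c * (b * e))
  rearrange = ℕ-Ring.solve-∀
  regroup : ∀ y x d → y -ℤ x -ℤ d ≡ y -ℤ (x +ℤ d)
  regroup = solve-∀

count-from≡𝟙-squareChain : ∀ m .{{_ : NonZero m}} {n} (h : Vec ℤ n) (x : Fin m) →
  sum (map (λ s → 𝟙 (counted? m h (x ∷ s))) (allTuples m n)) ≡ 𝟙-squareChain m h (+ toℕ x)
count-from≡𝟙-squareChain m []      x = trans (+-identityʳ _) (𝟙-counted-[] m x)
count-from≡𝟙-squareChain m {suc n} (d ∷ h) x = begin
  sum (map (λ s → 𝟙 (counted? m (d ∷ h) (x ∷ s))) (allTuples m (suc n)))
    ≡⟨ sum-allTuples-suc m n _ ⟩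
  sum (map (λ y → sum (map (λ s → 𝟙 (counted? m (d ∷ h) (x ∷ y ∷ s))) (allTuples m n))) (allFin m))
    ≡⟨ cong sum (List.map-cong row (allFin m)) ⟩
  sum (map (λ y → sx * (step y * 𝟙-squareChain m h (+ toℕ y))) (allFin m))
    ≡⟨ sum-map-*ˡ sx _ (allFin m) ⟩
  sx * sum (map (λ y → step y * 𝟙-squareChain m h (+ toℕ y)) (allFin m))
    ≡⟨ cong (sx *_) (sum-allFin m (λ j → 𝟙∣ m (+ j -ℤ (+ toℕ x +ℤ d)) * 𝟙-squareChain m h (+ j))) ⟩
  sx * ∑[ j < m ] (𝟙∣ m (+ j -ℤ (+ toℕ x +ℤ d)) * 𝟙-squareChain m h (+ j))
    ≡⟨ cong (sx *_) (∑-select m (𝟙-squareChain-periodic m h) (+ toℕ x +ℤ d)) ⟩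
  sx * 𝟙-squareChain m h (+ toℕ x +ℤ d)
    ∎
  where
  open ≡-Reasoning
  sx : ℕ
  sx = 𝟙-square m (+ toℕ x)
  step : Fin m → ℕ
  step y = 𝟙∣ m (+ toℕ y -ℤ (+ toℕ x +ℤ d))
  row : ∀ y → sum (map (λ s → 𝟙 (counted? m (d ∷ h) (x ∷ y ∷ s))) (allTuples m n)) ≡
              sx * (step y * 𝟙-squareChain m h (+ toℕ y))
  row y = begin
    sum (map (λ s → 𝟙 (counted? m (d ∷ h) (x ∷ y ∷ s))) (allTuples m n))
      ≡⟨ cong sum (List.map-cong (𝟙-counted-∷∷ m d h x y) (allTuples m n)) ⟩
    sum (map (λ s → sx * (step y * 𝟙 (counted? m h (y ∷ s)))) (allTuples m n))
      ≡⟨ sum-map-*ˡ sx _ (allTuples m n) ⟩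
    sx * sum (map (λ s → step y * 𝟙 (counted? m h (y ∷ s))) (allTuples m n))
      ≡⟨ cong (sx *_) (sum-map-*ˡ (step y) _ (allTuples m n)) ⟩
    sx * (step y * sum (map (λ s → 𝟙 (counted? m h (y ∷ s))) (allTuples m n)))
      ≡⟨ cong (λ c → sx * (step y * c)) (count-from≡𝟙-squareChain m h y) ⟩
    sx * (step y * 𝟙-squareChain m h (+ toℕ y))
      ∎

N≡∑ : ∀ m .{{_ : NonZero m}} {n} (h : Vec ℤ n) → N {suc n} h m ≡ ∑[ j < m ] 𝟙-squareChain m h (+ j)
N≡∑ m {n} h = begin
  N {suc n} h m
    ≡⟨ length-filter≡sum-𝟙 (counted? m h) (allTuples m (suc n)) ⟩
  sum (map (𝟙 ∘ counted? m h) (allTuples m (suc n)))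
    ≡⟨ sum-allTuples-suc m n _ ⟩
  sum (map (λ x → sum (map (λ s → 𝟙 (counted? m h (x ∷ s))) (allTuples m n))) (allFin m))
    ≡⟨ cong sum (List.map-cong (count-from≡𝟙-squareChain m h) (allFin m)) ⟩
  sum (map (λ x → 𝟙-squareChain m h (+ toℕ x)) (allFin m))
    ≡⟨ sum-allFin m (λ j → 𝟙-squareChain m h (+ j)) ⟩
  ∑[ j < m ] 𝟙-squareChain m h (+ j)
    ∎
  where open ≡-Reasoning

∣m-n∣≤k : ∀ {m n k} → m ≤ n → n ≤ m + k → ∣ + m -ℤ + n ∣ ≤ k
∣m-n∣≤k {m} {n} {k} m≤n n≤m+k = begin
  ∣ + m -ℤ + n ∣   ≡⟨ ℤP.∣i-j∣≡∣j-i∣ (+ m) (+ n) ⟩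
  ∣ + n -ℤ + m ∣   ≡⟨ cong ∣_∣ (trans (ℤP.m-n≡m⊖n n m) (ℤP.⊖-≥ m≤n)) ⟩
  n ∸ m            ≤⟨ m≤n+o⇒m∸n≤o n m n≤m+k ⟩
  k                ∎
  where open ≤-Reasoning

N-error-bound : ∀ {p} → Prime p → ∀ {a b} → a ≤ b → ∀ {n} (h : Vec ℤ n) →
  ∣ + N {suc n} h (p ^ b) -ℤ + (p ^ (b ∸ a)) *ℤ + N {suc n} h (p ^ a) ∣ ≤ 4 * suc n * p ^ (b ∸ a)
N-error-bound {p} pr {a} {b} a≤b {n} h = begin
  ∣ + Nᵇ -ℤ + q *ℤ + Nᵃ ∣   ≡⟨ cong (λ z → ∣ + Nᵇ -ℤ z ∣) (ℤP.pos-* q Nᵃ) ⟨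
  ∣ + Nᵇ -ℤ + (q * Nᵃ) ∣    ≤⟨ ∣m-n∣≤k upper lower ⟩
  q * (4 * suc n)          ≡⟨ *-comm q (4 * suc n) ⟩
  4 * suc n * q            ∎
  where
  open ≤-Reasoning
  instance
    p≢0 : NonZero p
    p≢0 = prime⇒nonZero pr
    pᵃ≢0 : NonZero (p ^ a)
    pᵃ≢0 = m^n≢0 p a
    pᵇ≢0 : NonZero (p ^ b)
    pᵇ≢0 = m^n≢0 p b
  q = p ^ (b ∸ a)
  Nᵃ = N {suc n} h (p ^ a)
  Nᵇ = N {suc n} h (p ^ b)
  ∑-over-pᵇ : ∀ {f} → Periodic (p ^ a) f → ∑[ j < p ^ b ] f (+ j) ≡ q * ∑[ t < p ^ a ] f (+ t)
  ∑-over-pᵇ {f} f-per = trans (cong (λ k → ∑[ j < k ] f (+ j)) pᵇ≡qpᵃ) (∑-periodic (p ^ a) f-per q)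
    where
    pᵇ≡qpᵃ : p ^ b ≡ q * p ^ a
    pᵇ≡qpᵃ = trans (cong (p ^_) (sym (m∸n+n≡m a≤b))) (^-distribˡ-+-* p (b ∸ a) a)
  q*Nᵃ≡∑ : q * Nᵃ ≡ ∑[ j < p ^ b ] 𝟙-squareChain (p ^ a) h (+ j)
  q*Nᵃ≡∑ = trans (cong (q *_) (N≡∑ (p ^ a) h)) (sym (∑-over-pᵇ (𝟙-squareChain-periodic (p ^ a) h)))
  upper : Nᵇ ≤ q * Nᵃ
  upper = begin
    Nᵇ
      ≡⟨ N≡∑ (p ^ b) h ⟩
    ∑[ j < p ^ b ] 𝟙-squareChain (p ^ b) h (+ j)
      ≤⟨ ∑-mono-≤ (p ^ b) (λ j → 𝟙-squareChain-antitone (ℤ∣.∣ᵤ⇒∣ (^-monoʳ-∣ p a≤b)) h (+ j)) ⟩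
    ∑[ j < p ^ b ] 𝟙-squareChain (p ^ a) h (+ j)
      ≡⟨ q*Nᵃ≡∑ ⟨
    q * Nᵃ
      ∎
  lower : q * Nᵃ ≤ Nᵇ + q * (4 * suc n)
  lower = begin
    q * Nᵃ
      ≡⟨ q*Nᵃ≡∑ ⟩
    ∑[ j < p ^ b ] 𝟙-squareChain (p ^ a) h (+ j)
      ≤⟨ ∑-mono-≤ (p ^ b) (λ j → 𝟙-squareChain-lift pr a≤b h (+ j)) ⟩
    ∑[ j < p ^ b ] (obstructions (p ^ a) h (+ j) + 𝟙-squareChain (p ^ b) h (+ j))
      ≡⟨ ∑-distrib-+ (p ^ b) _ _ ⟩
    ∑[ j < p ^ b ] obstructions (p ^ a) h (+ j) + ∑[ j < p ^ b ] 𝟙-squareChain (p ^ b) h (+ j)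
      ≡⟨ cong₂ _+_ (∑-over-pᵇ (obstructions-periodic (p ^ a) h)) (sym (N≡∑ (p ^ b) h)) ⟩
    q * ∑[ t < p ^ a ] obstructions (p ^ a) h (+ t) + Nᵇ
      ≤⟨ +-monoˡ-≤ Nᵇ (*-monoʳ-≤ q (∑-obstructions (p ^ a) h)) ⟩
    q * (4 * suc n) + Nᵇ
      ≡⟨ +-comm _ Nᵇ ⟩
    Nᵇ + q * (4 * suc n)
      ∎

mainTheorem3 : (r : ℕ) → 2 ≤ r →
    Σ ℕ λ K → (0 < K) ×
      ((p : ℕ) → Prime p → (a b : ℕ) → 1 ≤ a → a ≤ b → (h : Vec ℤ (r ∸ 1)) →
        ∣ (+ N {r} h (p ^ b)) -ℤ ((+ (p ^ (b ∸ a))) *ℤ (+ N {r} h (p ^ a))) ∣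
          ≤ K * p ^ (b ∸ a))
mainTheorem3 zero    ()
mainTheorem3 (suc n) _ = 4 * suc n , s≤s z≤n , λ p pr a b _ a≤b h → N-error-bound pr a≤b h
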